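{- Let $L\subseteq\{0,1\}^*$ be a 0-1-symmetric language. The following four conditions are equivalent: (1) there is some $t\geq 0$ such that all graphs in $\mathcal{G}_L$ have treewidth at most $t$; (2) all graphs in $\mathcal{G}_L$ have treewidth $0$; (3) $\mathcal{G}_L=\{N_n\mid n\in\mathbb{N}, n\geq 1\}$, where $N_n$ is the edgeless graph on $n$ vertices; (4) $L\subseteq 0^*\cup 1^*$.
   Context: All graphs are finite, simple, undirected, with nonempty vertex sets, and graph classes are considered up to isomorphism. For $w\in\{0,1\}^*$ let $\widetilde{w}$ be obtained from $w$ by exchanging the letters 0 and 1; a language $L\subseteq\{0,1\}^*$ is 0-1-symmetric if $L=\{\widetilde w : w\in L\}$. For an alphabet $V$ and distinct $u,v\in V$, $h_{u,v}:V^*\to\{0,1\}^*$ is the monoid morphism with $u\mapsto 0$, $v\mapsto 1$ and $x\mapsto\lambda$ (empty word) for all other letters $x$. For a 0-1-symmetric $L$ and a nonempty word $w$ whose set of occurring letters is $V$, $G(L,w)$ is the graph with vertex set $V$ in which distinct $u,v$ are adjacent iff $h_{u,v}(w)\in L$. A graph is $L$-representable if it is isomorphic to some $G(L,w)$, and $\mathcal{G}_L$ denotes the class of all $L$-representable graphs. -}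

module Defs where

open import Level using (Level)
open import Data.Nat using (ℕ; zero; suc; _≤_)
open import Data.Bool using (Bool; true; false; not)
open import Data.Fin using (Fin)
open import Data.Fin.Properties using (_≟_)
open import Data.Fin.Subset using (Subset; ∣_∣) renaming (_∈_ to _∈ₛ_)
open import Data.List using (List; []; _∷_; map; length; _++_; take)
open import Data.List.Relation.Unary.All using (All)
open import Data.List.Relation.Unary.Unique.Propositional using (Unique)
open import Data.Product using (Σ; ∃; _×_; _,_; proj₁; proj₂)
open import Data.Sum using (_⊎_)
open import Data.Empty using (⊥; ⊥-elim)
open import Data.Unit using (⊤)
open import Relation.Nullary using (¬_; yes; no; Dec)
open import Relation.Binary.PropositionalEquality using (_≡_; _≢_; refl; sym; cong; subst)
open import Function using (_∘_)
open import Function.Bundles using (_↔_; _⇔_; Inverse; Equivalence; mk⇔)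

-- Words over {0,1}: 0 is `false`, 1 is `true`.
-- A language is a predicate on binary words.

Language : Set₁
Language = List Bool → Set

flipWord : List Bool → List Bool
flipWord = map not

Symmetric01 : Language → Set
Symmetric01 L = ∀ w → L w ⇔ L (flipWord w)

record Graph : Set₁ where
  field
    n      : ℕ                          -- the graph has (suc n) vertices
    Adj    : Fin (suc n) → Fin (suc n) → Set
    adjSym : ∀ {u v} → Adj u v → Adj v u
    irrefl : ∀ u → ¬ Adj u u

open Graph public

Vertex : Graph → Set
Vertex G = Fin (suc (n G))

_≅_ : Graph → Graph → Set
G ≅ H = Σ (Vertex G ↔ Vertex H) λ f →
          ∀ u v → Adj G u v ⇔ Adj H (Inverse.to f u) (Inverse.to f v)

-- edgeless graph N_{suc m} on (suc m) vertices
Edgeless : ℕ → Graph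
Edgeless m = record { n = m ; Adj = λ _ _ → ⊥ ; adjSym = λ () ; irrefl = λ _ () }

letter : ∀ {k} {x u v : Fin k} → Dec (x ≡ u) → Dec (x ≡ v) → List Bool
letter (yes _) _       = false ∷ []
letter (no _)  (yes _) = true ∷ []
letter (no _)  (no _)  = []

h : ∀ {k} → Fin k → Fin k → List (Fin k) → List Bool
h u v [] = []
h u v (x ∷ w) = letter (x ≟ u) (x ≟ v) ++ h u v w

h-swap : ∀ {k} (u v : Fin k) → u ≢ v → ∀ w → h v u w ≡ flipWord (h u v w)
h-swap u v u≢v [] = refl
h-swap u v u≢v (x ∷ w) with x ≟ u | x ≟ v
... | yes refl | yes refl = ⊥-elim (u≢v refl)
... | yes refl | no _ = cong (true ∷_) (h-swap u v u≢v w)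
... | no _ | yes refl = cong (false ∷_) (h-swap u v u≢v w)
... | no _ | no _ = h-swap u v u≢v w

-- G(L,w) for a word w over the alphabet Fin (suc k) (the letters
-- occurring in w are required to be all of Fin (suc k) in `Representable`).
GL : (L : Language) → Symmetric01 L → (k : ℕ) → List (Fin (suc k)) → Graph
GL L s k w = record
  { n = k
  ; Adj = λ u v → u ≢ v × L (h u v w)
  ; adjSym = λ { {u} {v} (u≢v , p) →
       (λ e → u≢v (sym e)) ,
       subst L (sym (h-swap u v u≢v w)) (Equivalence.to (s (h u v w)) p) }
  ; irrefl = λ u (u≢u , _) → u≢u refl
  }

open import Data.List.Membership.Propositional using () renaming (_∈_ to _∈ˡ_)

Representable : (L : Language) → Symmetric01 L → Graph → Set
Representable L s G =
  Σ ℕ λ k → Σ (List (Fin (suc k))) λ w → (∀ a → a ∈ˡ w) × (G ≅ GL L s k w)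

data WalkIn (G : Graph) (S : Vertex G → Set) : Vertex G → Vertex G → Set where
  here : ∀ {u} → S u → WalkIn G S u u
  step : ∀ {u x v} → S u → Adj G u x → WalkIn G S x v → WalkIn G S u v

ConnectedIn : (G : Graph) → (Vertex G → Set) → Set
ConnectedIn G S = ∀ a b → S a → S b → WalkIn G S a b

Connected : Graph → Set
Connected G = ConnectedIn G (λ _ → ⊤)

data Chain (G : Graph) : List (Vertex G) → Set where
  []  : Chain G []
  [-] : ∀ x → Chain G (x ∷ [])
  _∷_ : ∀ {x y xs} → Adj G x y → Chain G (y ∷ xs) → Chain G (x ∷ y ∷ xs)

HasCycle : Graph → Set
HasCycle G = Σ (List (Vertex G)) λ xs →
  (3 ≤ length xs) × Unique xs × Chain G (xs ++ take 1 xs)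

IsTree : Graph → Set
IsTree T = Connected T × ¬ HasCycle T

record TreeDecomposition (G T : Graph) : Set where
  field
    isTree : IsTree T
    bag    : Vertex T → Subset (suc (n G))
    cover  : ∀ v → ∃ λ i → v ∈ₛ bag i
    edges  : ∀ u v → Adj G u v → ∃ λ i → (u ∈ₛ bag i) × (v ∈ₛ bag i)
    conn   : ∀ v → ConnectedIn T (λ i → v ∈ₛ bag i)

open TreeDecomposition public

TreewidthAtMost : ℕ → Graph → Set₁
TreewidthAtMost t G = Σ Graph λ T → Σ (TreeDecomposition G T) λ D →
  ∀ i → ∣ bag D i ∣ ≤ suc t

Cond1 : (L : Language) → Symmetric01 L → Set₁
Cond1 L s = Σ ℕ λ t → ∀ G → Representable L s G → TreewidthAtMost t G

Cond2 : (L : Language) → Symmetric01 L → Set₁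
Cond2 L s = ∀ G → Representable L s G → TreewidthAtMost 0 G

-- 𝒢_L = { N_m | m ≥ 1 }  (up to isomorphism); Edgeless m has suc m vertices
Cond3 : (L : Language) → Symmetric01 L → Set₁
Cond3 L s = ∀ G → Representable L s G ⇔ (Σ ℕ λ m → G ≅ Edgeless m)

Cond4 : Language → Set
Cond4 L = ∀ w → L w → All (_≡ false) w ⊎ All (_≡ true) w

{-# OPTIONS --safe #-}
-- If some word x ∈ L uses both letters, replace every 0 of x by an enumeration of a set A and every
-- 1 by an enumeration of a disjoint set B, with |A| = |B| = t + 2. Every h_{a,b} with a ∈ A, b ∈ B
-- maps the result back to x, so the represented graph contains K_{t+2,t+2}. In a tree decomposition,
-- the sets of nodes whose bag contains a or b are subtrees which pairwise meet (at a bag of an edge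
-- a b′), so by the Helly property they share a node; its bag then contains all of A or all of B.
-- Conversely, if L ⊆ 0* ∪ 1* then h_{u,v}(w) contains both letters whenever u ≠ v both occur in w,
-- so every G(L,w) is edgeless, and edgeless graphs have treewidth 0 (a star with singleton bags).
module Submission where

open import Defs
open import Data.Bool as Bool using (Bool; true; false; not)
open import Data.Bool.Properties using (¬-not)
open import Data.Empty using (⊥; ⊥-elim)
open import Data.Fin using (Fin; zero; suc; _↑ˡ_; _↑ʳ_; splitAt; join)
import Data.Fin.Properties as Finₚ
open import Data.Fin.Subset using (Subset; ⁅_⁆; _-_; ∣_∣) renaming (_∈_ to _∈ₛ_; _∉_ to _∉ₛ_)
import Data.Fin.Subset.Properties as Subsetₚ
open import Data.List using (List; []; _∷_; _++_; [_]; length; tabulate; concatMap; allFin)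
import Data.List.Properties as Listₚ
open import Data.List.Membership.Propositional using (_∈_; _∉_)
import Data.List.Membership.Propositional.Properties as ∈ₚ
open import Data.List.Relation.Unary.All as All using (All; []; _∷_)
open import Data.List.Relation.Unary.All.Properties using (¬Any⇒All¬; tabulate⁺)
open import Data.List.Relation.Unary.Any using (here; there)
open import Data.List.Relation.Unary.AllPairs using ([]; _∷_)
open import Data.List.Relation.Unary.Unique.Propositional using (Unique)
import Data.List.Relation.Unary.Unique.Propositional.Properties as Uniqueₚ
open import Data.Nat using (ℕ; zero; suc; _+_; _≤_; _<_; z≤n; s≤s)
open import Data.Nat.Properties using (≤-reflexive; ≤-trans; <⇒≱; n<1+n; +-suc; +-identityʳ)
open import Data.Product as Product using (Σ; ∃; _×_; _,_; proj₁; proj₂)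
open import Data.Sum as Sum using (_⊎_; inj₁; inj₂)
open import Data.Unit using (⊤; tt)
open import Function using (_∘_; id)
open import Function.Construct.Identity using (↔-id)
open import Function.Bundles using (_⇔_; _↔_; mk⇔; Equivalence)
open import Function.Definitions using (Injective)
open import Relation.Nullary using (¬_; yes; no)
open import Relation.Unary using (U; _∩_; _∪_; _⊆_)
open import Relation.Binary.PropositionalEquality using (_≡_; _≢_; refl; sym; trans; cong; cong₂; subst)

unique-size : ∀ {n} {xs : List (Fin n)} {p : Subset n} → Unique xs → All (_∈ₛ p) xs → length xs ≤ ∣ p ∣
unique-size [] [] = z≤n
unique-size {xs = x ∷ _} {p} (x∉xs ∷ xs!) (x∈p ∷ xs⊆p) =
  ≤-trans (s≤s (unique-size xs! (All.zipWith ∈p-x (xs⊆p , x∉xs)))) (Subsetₚ.x∈p⇒∣p-x∣<∣p∣ x∈p)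
  where
  ∈p-x : ∀ {y} → y ∈ₛ p × x ≢ y → y ∈ₛ p - x
  ∈p-x (y∈p , x≢y) = Subsetₚ.x∈p∧x≢y⇒x∈p-y y∈p (x≢y ∘ sym)

unique-length : ∀ {n} {xs : List (Fin n)} → Unique xs → length xs ≤ n
unique-length {n} {xs} xs! =
  subst (length xs ≤_) (Subsetₚ.∣⊤∣≡n n) (unique-size xs! (All.universal (λ _ → Subsetₚ.∈⊤) xs))

image-size : ∀ {m n} (g : Fin m → Fin n) → Injective _≡_ _≡_ g →
  (p : Subset n) → (∀ α → g α ∈ₛ p) → m ≤ ∣ p ∣
image-size g g-inj p g⊆p =
  subst (_≤ ∣ p ∣) (Listₚ.length-tabulate g) (unique-size (Uniqueₚ.tabulate⁺ g-inj) (tabulate⁺ g⊆p))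

missed-by-small : ∀ {m n} (g : Fin m → Fin n) → Injective _≡_ _≡_ g →
  (p : Subset n) → ∣ p ∣ < m → ∃ λ α → g α ∉ₛ p
missed-by-small {m} g g-inj p small with Finₚ.all? (λ α → g α Subsetₚ.∈? p)
... | yes g⊆p = ⊥-elim (<⇒≱ small (image-size g g-inj p g⊆p))
... | no g⊈p = Finₚ.¬∀⟶∃¬ m _ (λ α → g α Subsetₚ.∈? p) g⊈p

module Walks (G : Graph) where

  private
    V : Set
    V = Vertex G

  open import Data.List.Membership.DecPropositional (Finₚ._≟_ {suc (n G)}) using (_∈?_)

  private
    variable
      S S′ : V → Set
      a b c x : V

  after : WalkIn G S a b → List V
  after (here _) = []
  after (step {x = y} _ _ w) = y ∷ after w

  vertices : WalkIn G S a b → List V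
  vertices {a = a} w = a ∷ after w

  IsPath : WalkIn G S a b → Set
  IsPath w = Unique (vertices w)

  start : WalkIn G S a b → S a
  start (here s) = s
  start (step s _ _) = s

  all-in : (w : WalkIn G S a b) → All S (vertices w)
  all-in (here s) = s ∷ []
  all-in (step s _ w) = s ∷ all-in w

  map : S ⊆ S′ → WalkIn G S a b → WalkIn G S′ a b
  map f (here s) = here (f s)
  map f (step s e w) = step (f s) e (map f w)

  _◅◅_ : WalkIn G S a b → WalkIn G S b c → WalkIn G S a c
  here _ ◅◅ w′ = w′
  step s e w ◅◅ w′ = step s e (w ◅◅ w′)

  reverse : WalkIn G S a b → WalkIn G S b a
  reverse (here s) = here s
  reverse (step s e w) = reverse w ◅◅ step (start w) (adjSym G e) (here s)

  avoid-or-exit : ∀ a → WalkIn G S x c → a ≢ c →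
    WalkIn G (S ∩ (_≢ a)) x c ⊎ ∃ λ y → Adj G a y × WalkIn G (S ∩ (_≢ a)) y c
  avoid-or-exit a (here s) a≢c = inj₁ (here (s , a≢c ∘ sym))
  avoid-or-exit a (step {x} s e w) a≢c with avoid-or-exit a w a≢c
  ... | inj₂ exit = inj₂ exit
  ... | inj₁ w′ with x Finₚ.≟ a
  ...   | yes refl = inj₂ (_ , e , w′)
  ...   | no x≢a = inj₁ (step (s , x≢a) e w′)

  last-exit : WalkIn G S a c → a ≢ c → ∃ λ y → Adj G a y × WalkIn G (S ∩ (_≢ a)) y c
  last-exit w a≢c with avoid-or-exit _ w a≢c
  ... | inj₁ w′ = ⊥-elim (proj₂ (start w′) refl)
  ... | inj₂ exit = exit

  suffix : (w : WalkIn G S a b) → IsPath w → c ∈ vertices w → Σ (WalkIn G S c b) IsPath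
  suffix w w! (here refl) = w , w!
  suffix (step _ _ w) (_ ∷ w!) (there c∈w) = suffix w w! c∈w

  erase : WalkIn G S a b → Σ (WalkIn G S a b) IsPath
  erase (here s) = here s , [] ∷ []
  erase {a = a} (step s e w) with erase w
  ... | w′ , w′! with a ∈? vertices w′
  ...   | yes a∈w′ = suffix w′ w′! a∈w′
  ...   | no a∉w′ = step s e w′ , ¬Any⇒All¬ _ a∉w′ ∷ w′!

  prefix : (w : WalkIn G S a b) → c ∈ vertices w → WalkIn G S a c
  prefix w (here refl) = here (start w)
  prefix (step s e w) (there c∈w) = step s e (prefix w c∈w)

  prefix-all : ∀ {P : V → Set} (w : WalkIn G S a b) (c∈w : c ∈ vertices w) →
    All P (vertices w) → All P (vertices (prefix w c∈w))
  prefix-all w (here refl) (p ∷ _) = p ∷ []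
  prefix-all (step _ _ w) (there c∈w) (p ∷ ps) = p ∷ prefix-all w c∈w ps

  prefix-path : (w : WalkIn G S a b) (c∈w : c ∈ vertices w) → IsPath w → IsPath (prefix w c∈w)
  prefix-path w (here refl) _ = [] ∷ []
  prefix-path (step _ _ w) (there c∈w) (a∉w ∷ w!) = prefix-all w c∈w a∉w ∷ prefix-path w c∈w w!

  chain-closing : (w : WalkIn G S a b) → Adj G b c → Chain G (vertices w ++ [ c ])
  chain-closing (here _) e = e ∷ [-] _
  chain-closing (step _ e w) e′ = e ∷ chain-closing w e′

  closing-cycle : (p : WalkIn G S a b) → IsPath p → All (c ≢_) (vertices p) →
    Adj G c a → Adj G b c → 2 ≤ length (vertices p) → HasCycle G
  closing-cycle p p! c∉p c~a b~c long = _ ∷ vertices p , s≤s long , c∉p ∷ p! , c~a ∷ chain-closing p b~c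

  detour-cycle : ∀ {u v} → Adj G u v → WalkIn G (_≢ u) v x → WalkIn G (_≢ v) x u → HasCycle G
  detour-cycle u~v w₁ w₂ with last-exit w₁ (λ v≡x → start w₂ (sym v≡x))
  ... | y , v~y , y⇝x with erase (map proj₂ y⇝x ◅◅ w₂)
  ...   | here _ , _ = ⊥-elim (proj₁ (start y⇝x) refl)
  ...   | p@(step _ _ _) , p! = closing-cycle p p! (All.map (_∘ sym) (all-in p)) v~y u~v (s≤s (s≤s z≤n))

  ∪-connected : ∀ {P Q : V → Set} → ConnectedIn G P → ConnectedIn G Q → (∃ λ c → P c × Q c) →
    ConnectedIn G (P ∪ Q)
  ∪-connected P-conn Q-conn _ a b (inj₁ a∈P) (inj₁ b∈P) = map inj₁ (P-conn a b a∈P b∈P)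
  ∪-connected P-conn Q-conn _ a b (inj₂ a∈Q) (inj₂ b∈Q) = map inj₂ (Q-conn a b a∈Q b∈Q)
  ∪-connected P-conn Q-conn (c , c∈P , c∈Q) a b (inj₁ a∈P) (inj₂ b∈Q) =
    map inj₁ (P-conn a c a∈P c∈P) ◅◅ map inj₂ (Q-conn c b c∈Q b∈Q)
  ∪-connected P-conn Q-conn (c , c∈P , c∈Q) a b (inj₂ a∈Q) (inj₁ b∈P) =
    map inj₂ (Q-conn a c a∈Q c∈Q) ◅◅ map inj₁ (P-conn c b c∈P b∈P)

  module _ (f : V → V) (f-adj : ∀ x → Adj G x (f x)) where

    Retreats : WalkIn G S a b → Set
    Retreats (here _) = ⊤
    Retreats (step {a} {y} _ _ _) = a ≡ f y

    no-fixed-point : f x ≢ x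
    no-fixed-point {x = x} fx≡x = irrefl G x (subst (Adj G x) fx≡x (f-adj x))

    close-orbit : (w : WalkIn G U x b) → IsPath w → Retreats w → f x ∈ vertices w →
      (∃ λ j → f (f j) ≡ j) ⊎ HasCycle G
    close-orbit w _ _ (here fx≡x) = ⊥-elim (no-fixed-point fx≡x)
    close-orbit (step _ _ _) _ x≡fy (there (here fx≡y)) = inj₁ (_ , trans (cong f (sym x≡fy)) fx≡y)
    close-orbit (step _ _ (here _)) _ _ (there (there ()))
    close-orbit (step _ x~y w@(step _ _ R)) (x∉w ∷ w!) _ (there (there fx∈R)) =
      inj₂ (closing-cycle (prefix w (there fx∈R)) (prefix-path w (there fx∈R) w!)
                          (prefix-all w (there fx∈R) x∉w) x~y (adjSym G (f-adj _)) (s≤s (s≤s z≤n)))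

    -- w is the f-orbit of zero read backwards, newest vertex first; its vertices are distinct,
    -- so |V| steps of fuel suffice.
    follow : (fuel : ℕ) (w : WalkIn G U x b) → IsPath w → Retreats w →
      suc (n G) < length (vertices w) + fuel → (∃ λ j → f (f j) ≡ j) ⊎ HasCycle G
    follow zero w w! _ overfull =
      ⊥-elim (<⇒≱ (subst (suc (n G) <_) (+-identityʳ _) overfull) (unique-length w!))
    follow {x = x} (suc fuel) w w! r overfull with f x ∈? vertices w
    ... | yes fx∈w = close-orbit w w! r fx∈w
    ... | no fx∉w = follow fuel (step tt (adjSym G (f-adj x)) w) (¬Any⇒All¬ _ fx∉w ∷ w!) refl
                      (subst (suc (n G) <_) (+-suc _ fuel) overfull)

    two-periodic-or-cycle : (∃ λ j → f (f j) ≡ j) ⊎ HasCycle G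
    two-periodic-or-cycle = follow (suc (n G)) (here {u = zero} tt) ([] ∷ []) tt (n<1+n _)

module _ (T : Graph) {I : Set} (S : I → Vertex T → Set) (S-conn : ∀ ι → ConnectedIn T (S ι)) where

  open Walks T

  towards : Connected T → ∀ {i ι} → ¬ S ι i → (∃ λ c → S ι c) →
    ∃ λ y → Adj T i y × (∀ x → S ι x → WalkIn T (_≢ i) y x)
  towards connected {i} {ι} i∉Sι (c , c∈Sι)
    with last-exit (connected i c tt tt) (λ i≡c → i∉Sι (subst (S ι) (sym i≡c) c∈Sι))
  ... | y , i~y , y⇝c = y , i~y , λ x x∈Sι →
          map proj₂ y⇝c ◅◅ map (λ z∈Sι z≡i → i∉Sι (subst (S ι) z≡i z∈Sι)) (S-conn ι c x c∈Sι x∈Sι)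

  -- Every node points to a neighbour in the direction of a set avoiding it. Following the pointers
  -- in a finite acyclic graph forces two adjacent nodes to point at each other, and a common point
  -- of their two sets gives a detour around the edge joining them.
  helly : IsTree T → (∀ ι κ → ∃ λ i → S ι i × S κ i) → ¬ (∀ i → ∃ λ ι → ¬ S ι i)
  helly (connected , acyclic) meet missing =
    Sum.[ mutual-pointers , acyclic ] (two-periodic-or-cycle next next-adj)
    where
    avoided : Vertex T → I
    avoided i = proj₁ (missing i)

    toward : ∀ i → ∃ λ y → Adj T i y × (∀ x → S (avoided i) x → WalkIn T (_≢ i) y x)
    toward i = towards connected (proj₂ (missing i)) (Product.map₂ proj₁ (meet (avoided i) (avoided i)))

    next : Vertex T → Vertex T
    next i = proj₁ (toward i)

    next-adj : ∀ i → Adj T i (next i)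
    next-adj i = proj₁ (proj₂ (toward i))

    reach : ∀ i x → S (avoided i) x → WalkIn T (_≢ i) (next i) x
    reach i = proj₂ (proj₂ (toward i))

    mutual-pointers : ¬ ∃ λ j → next (next j) ≡ j
    mutual-pointers (j , nnj≡j) =
      let x , x∈Sj , x∈Snj = meet (avoided j) (avoided (next j)) in
      acyclic (detour-cycle (next-adj j) (reach j x x∈Sj)
        (reverse (subst (λ z → WalkIn T (_≢ next j) z x) nnj≡j (reach (next j) x x∈Snj))))

biclique⇒¬TreewidthAtMost : ∀ (G : Graph) t (a b : Fin (2 + t) → Vertex G) →
  Injective _≡_ _≡_ a → Injective _≡_ _≡_ b →
  (∀ α β → Adj G (a α) (b β)) → ¬ TreewidthAtMost t G
biclique⇒¬TreewidthAtMost G t a b a-inj b-inj a~b (T , D , small) =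
  helly T S S-conn (isTree D) meet missing
  where
  open Walks T using (∪-connected)

  edge-bag : ∀ α β → ∃ λ i → a α ∈ₛ bag D i × b β ∈ₛ bag D i
  edge-bag α β = edges D (a α) (b β) (a~b α β)

  S : Fin (2 + t) × Fin (2 + t) → Vertex T → Set
  S (α , β) = (λ i → a α ∈ₛ bag D i) ∪ (λ i → b β ∈ₛ bag D i)

  S-conn : ∀ ι → ConnectedIn T (S ι)
  S-conn (α , β) = ∪-connected (conn D (a α)) (conn D (b β)) (edge-bag α β)

  meet : ∀ ι κ → ∃ λ i → S ι i × S κ i
  meet (α , _) (_ , β) = Product.map₂ (Product.map inj₁ inj₂) (edge-bag α β)

  missing : ∀ i → ∃ λ ι → ¬ S ι i
  missing i with missed-by-small a a-inj (bag D i) (s≤s (small i))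
               | missed-by-small b b-inj (bag D i) (s≤s (small i))
  ... | α , a∉ | β , b∉ = (α , β) , Sum.[ a∉ , b∉ ]

h-++ : ∀ {k} (u v : Fin k) xs ys → h u v (xs ++ ys) ≡ h u v xs ++ h u v ys
h-++ u v [] ys = refl
h-++ u v (x ∷ xs) ys =
  trans (cong (letter (x Finₚ.≟ u) (x Finₚ.≟ v) ++_) (h-++ u v xs ys))
        (sym (Listₚ.++-assoc (letter (x Finₚ.≟ u) (x Finₚ.≟ v)) (h u v xs) (h u v ys)))

h-∉ : ∀ {k} {u v : Fin k} {xs} → u ∉ xs → v ∉ xs → h u v xs ≡ []
h-∉ {xs = []} _ _ = refl
h-∉ {u = u} {v} {x ∷ xs} u∉ v∉ with x Finₚ.≟ u | x Finₚ.≟ v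
... | yes x≡u | _ = ⊥-elim (u∉ (here (sym x≡u)))
... | no _ | yes x≡v = ⊥-elim (v∉ (here (sym x≡v)))
... | no _ | no _ = h-∉ (u∉ ∘ there) (v∉ ∘ there)

h-once : ∀ {k} {u v : Fin k} {xs} → Unique xs → u ∈ xs → v ∉ xs → h u v xs ≡ [ false ]
h-once {xs = x ∷ xs} (x∉xs ∷ _) (here refl) v∉ with x Finₚ.≟ x
... | yes _ = cong (false ∷_) (h-∉ (λ x∈xs → All.lookup x∉xs x∈xs refl) (v∉ ∘ there))
... | no x≢x = ⊥-elim (x≢x refl)
h-once {u = u} {v} {x ∷ xs} (x∉xs ∷ xs!) (there u∈xs) v∉ with x Finₚ.≟ u | x Finₚ.≟ v
... | yes refl | _ = ⊥-elim (All.lookup x∉xs u∈xs refl)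
... | no _ | yes x≡v = ⊥-elim (v∉ (here (sym x≡v)))
... | no _ | no _ = h-once xs! u∈xs (v∉ ∘ there)

false∈h : ∀ {k} {u v : Fin k} {w} → u ∈ w → false ∈ h u v w
false∈h {w = x ∷ _} (here refl) with x Finₚ.≟ x
... | yes _ = here refl
... | no x≢x = ⊥-elim (x≢x refl)
false∈h {u = u} {v} {x ∷ _} (there u∈w) = ∈ₚ.∈-++⁺ʳ (letter (x Finₚ.≟ u) (x Finₚ.≟ v)) (false∈h u∈w)

true∈h : ∀ {k} {u v : Fin k} {w} → u ≢ v → v ∈ w → true ∈ h u v w
true∈h {u = u} {v} {w} u≢v v∈w =
  subst (true ∈_) (sym (h-swap v u (u≢v ∘ sym) w)) (∈ₚ.∈-map⁺ not (false∈h v∈w))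

module Blowup (m : ℕ) where

  A B : Fin m → Fin (m + m)
  A α = α ↑ˡ m
  B β = m ↑ʳ β

  A≢B : ∀ {α β} → A α ≢ B β
  A≢B {α} {β} A≡B
    with () ← trans (sym (Finₚ.splitAt-↑ˡ m α m)) (trans (cong (splitAt m) A≡B) (Finₚ.splitAt-↑ʳ m m β))

  A-inj : Injective _≡_ _≡_ A
  A-inj = Finₚ.↑ˡ-injective m _ _

  B-inj : Injective _≡_ _≡_ B
  B-inj = Finₚ.↑ʳ-injective m _ _

  block : Bool → List (Fin (m + m))
  block false = tabulate A
  block true = tabulate B

  blowup : List Bool → List (Fin (m + m))
  blowup = concatMap block

  h-block : ∀ α β c → h (A α) (B β) (block c) ≡ [ c ]
  h-block α β false = h-once (Uniqueₚ.tabulate⁺ A-inj) (∈ₚ.∈-tabulate⁺ α) B∉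
    where
    B∉ : B β ∉ tabulate A
    B∉ Bβ∈ = A≢B (sym (proj₂ (∈ₚ.∈-tabulate⁻ Bβ∈)))
  h-block α β true =
    trans (h-swap (B β) (A α) (A≢B ∘ sym) (tabulate B))
          (cong flipWord (h-once (Uniqueₚ.tabulate⁺ B-inj) (∈ₚ.∈-tabulate⁺ β) A∉))
    where
    A∉ : A α ∉ tabulate B
    A∉ Aα∈ = A≢B (proj₂ (∈ₚ.∈-tabulate⁻ Aα∈))

  h-blowup : ∀ α β x → h (A α) (B β) (blowup x) ≡ x
  h-blowup α β [] = refl
  h-blowup α β (c ∷ x) =
    trans (h-++ (A α) (B β) (block c) (blowup x)) (cong₂ _++_ (h-block α β c) (h-blowup α β x))

  blowup-covers : ∀ {x} → false ∈ x → true ∈ x → ∀ z → z ∈ blowup x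
  blowup-covers {x} 0∈x 1∈x z = subst (_∈ blowup x) (Finₚ.join-splitAt m m z) (covers (splitAt m z))
    where
    covers : ∀ s → join m m s ∈ blowup x
    covers (inj₁ α) = ∈ₚ.∈-concat⁺′ (∈ₚ.∈-tabulate⁺ α) (∈ₚ.∈-map⁺ block 0∈x)
    covers (inj₂ β) = ∈ₚ.∈-concat⁺′ (∈ₚ.∈-tabulate⁺ β) (∈ₚ.∈-map⁺ block 1∈x)

HasNoEdges : Graph → Set
HasNoEdges G = ∀ u v → ¬ Adj G u v

edgeless-≅ : ∀ G H (f : Vertex G ↔ Vertex H) → HasNoEdges G → HasNoEdges H → G ≅ H
edgeless-≅ _ _ f no-edges-G no-edges-H =
  f , λ u v → mk⇔ (⊥-elim ∘ no-edges-G u v) (⊥-elim ∘ no-edges-H _ _)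

Star : ℕ → Graph
Star k = record
  { n = k
  ; Adj = λ u v → u ≢ v × (u ≡ zero ⊎ v ≡ zero)
  ; adjSym = λ (u≢v , centre) → u≢v ∘ sym , Sum.swap centre
  ; irrefl = λ u (u≢u , _) → u≢u refl
  }

module _ {k : ℕ} where

  centre-between : ∀ {u v w} → Adj (Star k) u v → Adj (Star k) v w → u ≢ w → v ≡ zero
  centre-between (_ , inj₂ v≡0) _ _ = v≡0
  centre-between (_ , inj₁ _) (_ , inj₁ v≡0) _ = v≡0
  centre-between (_ , inj₁ u≡0) (_ , inj₂ w≡0) u≢w = ⊥-elim (u≢w (trans u≡0 (sym w≡0)))

  star-acyclic : ¬ HasCycle (Star k)
  star-acyclic ([] , () , _)
  star-acyclic (_ ∷ [] , s≤s () , _)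
  star-acyclic (_ ∷ _ ∷ [] , s≤s (s≤s ()) , _)
  star-acyclic (_ ∷ _ ∷ _ ∷ [] , _ , (x₁≢x₂ ∷ x₁≢x₃ ∷ []) ∷ (x₂≢x₃ ∷ []) ∷ _ , e₁₂ ∷ e₂₃ ∷ e₃₁ ∷ _) =
    x₂≢x₃ (trans (centre-between e₁₂ e₂₃ x₁≢x₃) (sym (centre-between e₂₃ e₃₁ (x₁≢x₂ ∘ sym))))
  star-acyclic (_ ∷ _ ∷ _ ∷ _ ∷ _ , _ , (_ ∷ x₁≢x₃ ∷ _) ∷ (x₂≢x₃ ∷ x₂≢x₄ ∷ _) ∷ _ , e₁₂ ∷ e₂₃ ∷ e₃₄ ∷ _) =
    x₂≢x₃ (trans (centre-between e₁₂ e₂₃ x₁≢x₃) (sym (centre-between e₂₃ e₃₄ x₂≢x₄)))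

  from-centre : ∀ b → WalkIn (Star k) U zero b
  from-centre zero = here tt
  from-centre (suc b) = step tt ((λ ()) , inj₁ refl) (here tt)

  star-connected : Connected (Star k)
  star-connected zero b _ _ = from-centre b
  star-connected (suc a) b _ _ = step tt ((λ ()) , inj₂ refl) (from-centre b)

HasNoEdges⇒TreewidthAtMost0 : ∀ G → HasNoEdges G → TreewidthAtMost 0 G
HasNoEdges⇒TreewidthAtMost0 G no-edges = Star (n G) , D , λ i → ≤-reflexive (Subsetₚ.∣⁅x⁆∣≡1 i)
  where
  D : TreeDecomposition G (Star (n G))
  D = record
    { isTree = star-connected , star-acyclic
    ; bag = ⁅_⁆
    ; cover = λ v → v , Subsetₚ.x∈⁅x⁆ v
    ; edges = λ u v u~v → ⊥-elim (no-edges u v u~v)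
    ; conn = λ v i j v∈i v∈j → subst (WalkIn (Star (n G)) (λ l → v ∈ₛ ⁅ l ⁆) i)
               (trans (sym (Subsetₚ.x∈⁅y⁆⇒x≡y i v∈i)) (Subsetₚ.x∈⁅y⁆⇒x≡y j v∈j)) (here v∈i)
    }

all≡-or-∈not : ∀ c x → All (_≡ c) x ⊎ not c ∈ x
all≡-or-∈not c [] = inj₁ []
all≡-or-∈not c (d ∷ x) with d Bool.≟ c
... | yes d≡c = Sum.map (d≡c ∷_) there (all≡-or-∈not c x)
... | no d≢c = inj₂ (here (sym (¬-not d≢c)))

module _ (L : Language) (s : Symmetric01 L) where

  Cond1⇒¬mixed : Cond1 L s → ∀ {x} → L x → false ∈ x → true ∈ x → ⊥
  Cond1⇒¬mixed (t , bounded) {x} x∈L 0∈x 1∈x =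
    biclique⇒¬TreewidthAtMost G t A B A-inj B-inj A~B
      (bounded G (suc t + (2 + t) , blowup x , blowup-covers 0∈x 1∈x , ↔-id _ , λ _ _ → mk⇔ id id))
    where
    open Blowup (2 + t)

    -- suc (suc t + (2 + t)) reduces to (2 + t) + (2 + t), the alphabet size of blowup.
    G : Graph
    G = GL L s (suc t + (2 + t)) (blowup x)

    A~B : ∀ α β → Adj G (A α) (B β)
    A~B α β = A≢B , subst L (sym (h-blowup α β x)) x∈L

  Cond1⇒Cond4 : Cond1 L s → Cond4 L
  Cond1⇒Cond4 bounded x x∈L with all≡-or-∈not false x
  ... | inj₁ all0 = inj₁ all0
  ... | inj₂ 1∈x with all≡-or-∈not true x
  ...   | inj₁ all1 = inj₂ all1
  ...   | inj₂ 0∈x = ⊥-elim (Cond1⇒¬mixed bounded x∈L 0∈x 1∈x)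

  GL-edgeless : Cond4 L → ∀ {k} {w : List (Fin (suc k))} → (∀ a → a ∈ w) → HasNoEdges (GL L s k w)
  GL-edgeless constant covers u v (u≢v , uv∈L) with constant _ uv∈L
  ... | inj₁ all0 with () ← All.lookup all0 (true∈h u≢v (covers v))
  ... | inj₂ all1 with () ← All.lookup all1 (false∈h (covers u))

  Cond4⇒Cond3 : Cond4 L → Cond3 L s
  Cond4⇒Cond3 constant G = mk⇔ to from
    where
    to : Representable L s G → ∃ λ m → G ≅ Edgeless m
    to (k , w , covers , f , f-adj) =
      k , edgeless-≅ G (Edgeless k) f
            (λ u v → GL-edgeless constant covers _ _ ∘ Equivalence.to (f-adj u v)) (λ _ _ ())
    from : (∃ λ m → G ≅ Edgeless m) → Representable L s G
    from (m , f , f-adj) =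
      m , allFin (suc m) , ∈ₚ.∈-allFin ,
      edgeless-≅ G (GL L s m (allFin (suc m))) f
        (λ u v → Equivalence.to (f-adj u v)) (GL-edgeless constant ∈ₚ.∈-allFin)

  Cond3⇒Cond2 : Cond3 L s → Cond2 L s
  Cond3⇒Cond2 edgeless G G∈𝒢 with Equivalence.to (edgeless G) G∈𝒢
  ... | _ , _ , f-adj = HasNoEdges⇒TreewidthAtMost0 G (λ u v → Equivalence.to (f-adj u v))

mainTheorem5 : (L : Language) (s : Symmetric01 L) →
    (Cond1 L s ⇔ Cond2 L s) × (Cond1 L s ⇔ Cond3 L s) × (Cond1 L s ⇔ Cond4 L)
mainTheorem5 L s = mk⇔ (3⇒2 ∘ 1⇒3) 2⇒1 , mk⇔ 1⇒3 (2⇒1 ∘ 3⇒2) , mk⇔ 1⇒4 (2⇒1 ∘ 3⇒2 ∘ 4⇒3)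
  where
  1⇒4 : Cond1 L s → Cond4 L
  1⇒4 = Cond1⇒Cond4 L s

  4⇒3 : Cond4 L → Cond3 L s
  4⇒3 = Cond4⇒Cond3 L s

  3⇒2 : Cond3 L s → Cond2 L s
  3⇒2 = Cond3⇒Cond2 L s

  2⇒1 : Cond2 L s → Cond1 L s
  2⇒1 = 0 ,_

  1⇒3 : Cond1 L s → Cond3 L s
  1⇒3 = 4⇒3 ∘ 1⇒4
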